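{- Let $K,d$ be positive integers. For $k=1,\ldots,K$ let $\{a_{k,n}\}_{n=1}^\infty$, $\{b_{k,n}\}_{n=1}^\infty$ be sequences of non-zero integers such that the partial sums $\alpha_{k,N}=\sum_{n=1}^N\frac{b_{k,n}}{a_{k,n}}$ converge as $N\to\infty$. Let $\mathcal P$ be a set of primes consisting either of a single prime or of infinitely many primes, and assume $p\nmid\gcd(b_{k,n},a_{k,n})$ for all $p\in\mathcal P$, $k=1,\ldots,K$, $n\in\mathbb N$. Put $a_{0,n}=1$. Suppose that for each $k=1,\ldots,K$ and each $p\in\mathcal P$: for every $N\in\mathbb N$ there is exactly one $n\le N$ with $\nu_p(a_{k,n})=\max_{1\le m\le N}\nu_p(a_{k,m})$; and for all sufficiently large $N$, $$\max_{1\le n\le N}\nu_p(a_{k,n})>d\max_{1\le n\le N}\nu_p(a_{k-1,n}).$$ If $\mathcal P=\{p\}$, assume additionally that $\lim_{N\to\infty}\big(\max_{1\le n\le N}\nu_p(a_{k,n})-d\max_{1\le n\le N}\nu_p(a_{k-1,n})\big)=\infty$ for each $k=1,\ldots,K$. Let $P\in\mathbb Z[x_1,\ldots,x_K]$ be a non-zero polynomial of degree at most $d$. Then $P(\alpha_{1,N},\ldots,\alpha_{K,N})\ne0$ for all sufficiently large $N$.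
   Context: $\nu_p$ is the $p$-adic valuation; degree means total degree. -}

module Defs where

open import Data.Nat as ℕ using (ℕ; zero; suc; _⊔_)
open import Data.Nat.Divisibility using (_∣?_)
open import Data.Nat.DivMod using (_/_)
open import Data.Integer as ℤ using (ℤ; +_; -[1+_])
open import Data.Rational as ℚ using (ℚ)
open import Data.List using (List; []; _∷_; map; concatMap; upTo)
open import Data.Vec using (Vec; []; _∷_)
open import Relation.Nullary using (yes; no)

-- p-adic valuation of a natural number (for p ≥ 2; junk value 0 for p < 2
-- and for m = 0).  `go fuel m` strips factors p from m, fuel m suffices.
νℕ : ℕ → ℕ → ℕ
νℕ zero m = 0
νℕ (suc zero) m = 0
νℕ (suc (suc q)) m = go m m
  where
  go : ℕ → ℕ → ℕ
  go zero _ = 0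
  go (suc f) zero = 0
  go (suc f) (suc m) with suc (suc q) ∣? suc m
  ... | yes _ = suc (go f (suc m / suc (suc q)))
  ... | no  _ = 0

ν : ℕ → ℤ → ℕ
ν p z = νℕ p ℤ.∣ z ∣

maxUpTo : (ℕ → ℕ) → ℕ → ℕ
maxUpTo f zero = 0
maxUpTo f (suc N) = maxUpTo f N ⊔ f (suc N)

-- the integer b/a as a rational (junk 0 for a = 0)
frac : ℤ → ℤ → ℚ
frac b (+ zero) = ℚ.0ℚ
frac b (+ suc m) = b ℚ./ suc m
frac b -[1+ m ] = (ℤ.- b) ℚ./ suc m

sumTo : (ℕ → ℚ) → ℕ → ℚ
sumTo f zero = ℚ.0ℚ
sumTo f (suc N) = sumTo f N ℚ.+ f (suc N)

α : (ℕ → ℕ → ℤ) → (ℕ → ℕ → ℤ) → ℕ → ℕ → ℚ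
α a b k N = sumTo (λ n → frac (b k n) (a k n)) N

ext : (ℕ → ℕ → ℤ) → ℕ → ℕ → ℤ
ext a zero n = + 1
ext a (suc k) n = a (suc k) n

-- polynomials in K variables: coefficient functions on exponent vectors
-- total degree of an exponent vector
deg : ∀ {K} → Vec ℕ K → ℕ
deg [] = 0
deg (e ∷ es) = e ℕ.+ deg es

-- all exponent vectors with every entry ≤ d (each listed exactly once);
-- this contains every exponent vector of total degree ≤ d
exps : (K d : ℕ) → List (Vec ℕ K)
exps zero d = [] ∷ []
exps (suc K) d = concatMap (λ i → map (i ∷_) (exps K d)) (upTo (suc d))

powℚ : ℚ → ℕ → ℚ
powℚ x zero = ℚ.1ℚ
powℚ x (suc n) = x ℚ.* powℚ x n

monomial : ∀ {K} → Vec ℕ K → Vec ℚ K → ℚ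
monomial [] [] = ℚ.1ℚ
monomial (e ∷ es) (x ∷ xs) = powℚ x e ℚ.* monomial es xs

sumℚ : List ℚ → ℚ
sumℚ [] = ℚ.0ℚ
sumℚ (q ∷ qs) = q ℚ.+ sumℚ qs

-- evaluation of the polynomial with coefficient function c (supported in
-- total degree ≤ d) at the point x
evalPoly : (K d : ℕ) → (Vec ℕ K → ℤ) → Vec ℚ K → ℚ
evalPoly K d c x = sumℚ (map (λ e → (c e ℚ./ 1) ℚ.* monomial e x) (exps K d))

module Submission where

-- Fix a prime p ∈ 𝒫 and let M_k(N) = max_{n ≤ N} ν_p(a_{k,n}). The maximum is attained
-- at a single n, and there p ∤ b_{k,n}, so by the ultrametric inequality the partial sum
-- α_{k,N} has valuation exactly −M_k(N); a monomial c_e α^e therefore has valuation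
-- ν_p(c_e) − Σ_k e_k M_k. Let e* be the colexicographically largest exponent vector with
-- c_{e*} ≠ 0. Once M_{k+1} > ν_p(c_{e*}) + d·M_k for all k, the e*-term has strictly
-- smaller valuation than every other term of degree ≤ d, so P(α_N) has that valuation and
-- is non-zero. For a single prime the extra hypothesis supplies the slack ν_p(c_{e*}); with
-- infinitely many primes one takes p > |c_{e*}|, so that ν_p(c_{e*}) = 0.

open import Defs

open import Data.Nat as ℕ using (ℕ; zero; suc; _≤_; _<_; _^_; s≤s; z≤n)
import Data.Nat.Properties as ℕ
open import Data.Nat.Divisibility using (_∣_; _∤_; _∣?_; _∣0; ∣1⇒≡1; ∣⇒≤; m∣m*n; ∣-trans)
open import Data.Nat.DivMod using (_/_; m*[n/m]≡n; m/n<m; m≥n⇒m/n>0)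
open import Data.Nat.GCD using (gcd; gcd-greatest)
open import Data.Nat.Primality using (Prime; euclidsLemma; prime⇒nonZero; ¬prime[1])
open import Data.Nat.Tactic.RingSolver using () renaming (solve-∀ to solveℕ-∀)
open import Data.Integer as ℤ using (ℤ; 0ℤ; +_; -[1+_]; ∣_∣)
import Data.Integer.Properties as ℤ
import Data.Integer.Divisibility.Signed as Signed
open import Data.Integer.Tactic.RingSolver using (solve-∀)
open import Data.Rational as ℚ using (ℚ)
import Data.Rational.Properties as ℚ
open import Data.Rational.Unnormalised as ℚᵘ using (ℚᵘ; mkℚᵘ; ↥_; ↧_)
import Data.Rational.Unnormalised.Properties as ℚᵘ
open import Data.Fin using (Fin; toℕ)
open import Data.Vec using (Vec; []; _∷_; tabulate)
open import Data.Vec.Properties using (∷-injectiveˡ; ∷-injectiveʳ)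
open import Data.List using (List; []; _∷_; map)
open import Data.List.Membership.Propositional using (_∈_)
open import Data.List.Membership.Propositional.Properties using (∈-concat⁺′; ∈-map⁺; ∈-map⁻; ∈-upTo⁺)
open import Data.List.Relation.Binary.Disjoint.Propositional using (Disjoint)
open import Data.List.Relation.Unary.Any using (here; there)
import Data.List.Relation.Unary.All as All
import Data.List.Relation.Unary.All.Properties as All
open import Data.List.Relation.Unary.AllPairs using ([]; _∷_)
import Data.List.Relation.Unary.AllPairs as AllPairs
import Data.List.Relation.Unary.AllPairs.Properties as AllPairs
open import Data.List.Relation.Unary.Unique.Propositional using (Unique)
import Data.List.Relation.Unary.Unique.Propositional.Properties as Unique
open import Data.Product using (∃; _×_; _,_)
open import Data.Sum using (_⊎_; inj₁; inj₂; [_,_]′)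
open import Function using (_∘_)
open import Function.Bundles using (_⇔_; Equivalence)
open import Relation.Binary.Definitions using (tri<; tri≈; tri>)
open import Relation.Binary.PropositionalEquality
  using (_≡_; _≢_; refl; sym; trans; cong; cong₂; subst; module ≡-Reasoning)
open import Relation.Nullary using (¬_; ¬?; yes; no; contradiction)
open import Relation.Unary using (Decidable)

-- The fuelled loop of νℕ lives in an anonymous where-block of Defs. The meta νℕ-loop is
-- solved to it by unification against one unfolding of νℕ (the with-abstractions turn
-- that into a pattern constraint), so that the loop can be reasoned about for any fuel.
mutual
  νℕ-loop : ℕ → ℕ → ℕ → ℕ → ℕ
  νℕ-loop = _

  νℕ-step : ∀ q m → suc (suc q) ∣ suc m →
    νℕ (suc (suc q)) (suc m) ≡ suc (νℕ-loop q (suc m) m (suc m / suc (suc q)))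
  νℕ-step q m p∣m with suc (suc q) ∣? suc m
  ... | no p∤m = contradiction p∣m p∤m
  ... | yes _ with suc m / suc (suc q)
  ...   | m/p with suc m
  ...     | m′ = refl

νℕ-loop-factorisation : ∀ q m f x → 1 ≤ x → x ≤ f →
  ∃ λ w → x ≡ suc (suc q) ^ νℕ-loop q m f x ℕ.* w × suc (suc q) ∤ w
νℕ-loop-factorisation q m (suc f) (suc x) _ x≤f with suc (suc q) ∣? suc x
... | no p∤x = suc x , sym (ℕ.*-identityˡ (suc x)) , p∤x
... | yes p∣x =
  let w , x/p≡ , p∤w = νℕ-loop-factorisation q m f (suc x / p) (m≥n⇒m/n>0 (∣⇒≤ p∣x)) x/p≤f
  in w , (begin
    suc x                 ≡⟨ sym (m*[n/m]≡n p∣x) ⟩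
    p ℕ.* (suc x / p)     ≡⟨ cong (p ℕ.*_) x/p≡ ⟩
    p ℕ.* (p ^ v ℕ.* w)   ≡⟨ sym (ℕ.*-assoc p (p ^ v) w) ⟩
    p ℕ.* p ^ v ℕ.* w     ∎) , p∤w
  where
  open ≡-Reasoning
  p v : ℕ
  p = suc (suc q)
  v = νℕ-loop q m f (suc x / p)
  x/p≤f : suc x / p ≤ f
  x/p≤f = ℕ.≤-pred (ℕ.≤-trans (m/n<m (suc x) p (s≤s (s≤s z≤n))) x≤f)

νℕ-factorisation : ∀ {p} → Prime p → ∀ {x} → 1 ≤ x → ∃ λ w → x ≡ p ^ νℕ p x ℕ.* w × p ∤ w
νℕ-factorisation {suc (suc q)} _ {x} 1≤x = νℕ-loop-factorisation q x x x 1≤x ℕ.≤-refl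

νℕ>0⇒∣ : ∀ {p} → Prime p → ∀ {x} → 1 ≤ x → 1 ≤ νℕ p x → p ∣ x
νℕ>0⇒∣ {p} p-prime {x} 1≤x 1≤ν with νℕ p x | νℕ-factorisation p-prime 1≤x
... | suc v | w , x≡ , _ = subst (p ∣_) (sym x≡) (∣-trans (m∣m*n (p ^ v)) (m∣m*n w))

∣∣>0 : ∀ {z} → z ≢ 0ℤ → 0 < ∣ z ∣
∣∣>0 z≢0 = ℕ.n≢0⇒n>0 (z≢0 ∘ ℤ.∣i∣≡0⇒i≡0)

frac-≃ : ∀ b a → a ≢ 0ℤ →
  ∃ λ n → ∃ λ d → ℚ.toℚᵘ (frac b a) ℚᵘ.≃ mkℚᵘ n d × ∣ n ∣ ≡ ∣ b ∣ × suc d ≡ ∣ a ∣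
frac-≃ b (+ zero) a≢0 = contradiction refl a≢0
frac-≃ b (+ suc d) _ = b , d , ℚ.toℚᵘ-fromℚᵘ (mkℚᵘ b d) , refl , refl
frac-≃ b -[1+ d ] _ = ℤ.- b , d , ℚ.toℚᵘ-fromℚᵘ (mkℚᵘ (ℤ.- b) d) , ℤ.∣-i∣≡∣i∣ b , refl

≤-maxUpTo : ∀ f {N n} → 1 ≤ n → n ≤ N → f n ≤ maxUpTo f N
≤-maxUpTo f {zero} 1≤n n≤0 = contradiction (ℕ.≤-trans 1≤n n≤0) λ ()
≤-maxUpTo f {suc N} 1≤n n≤N+1 with ℕ.m≤n⇒m<n∨m≡n n≤N+1
... | inj₁ n≤N = ℕ.≤-trans (≤-maxUpTo f 1≤n (ℕ.≤-pred n≤N)) (ℕ.m≤m⊔n (maxUpTo f N) (f (suc N)))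
... | inj₂ refl = ℕ.m≤n⊔m (maxUpTo f N) (f (suc N))

UniqueArgmax : (ℕ → ℕ) → ℕ → ℕ → Set
UniqueArgmax f N n =
  1 ≤ n × n ≤ N × f n ≡ maxUpTo f N × (∀ m → 1 ≤ m → m ≤ N → f m ≡ maxUpTo f N → m ≡ n)

module Valuation (p : ℕ) (p-prime : Prime p) where

  open import Data.Integer using (_*_; _+_; -_)

  infix 10 p^_
  p^_ : ℕ → ℤ
  p^ k = + (p ^ k)

  p^-nonZero : ∀ k → ℤ.NonZero (p^ k)
  p^-nonZero k = ℕ.m^n≢0 p k {{prime⇒nonZero p-prime}}

  p^-+ : ∀ m n → p^ (m ℕ.+ n) ≡ p^ m * p^ n
  p^-+ m n = trans (cong +_ (ℕ.^-distribˡ-+-* p m n)) (ℤ.pos-* (p ^ m) (p ^ n))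

  ∤1 : p ∤ 1
  ∤1 p∣1 with ∣1⇒≡1 p∣1
  ... | refl = ¬prime[1] p-prime

  ∤-* : ∀ a b → p ∤ ∣ a ∣ → p ∤ ∣ b ∣ → p ∤ ∣ a * b ∣
  ∤-* a b p∤a p∤b p∣ab =
    [ p∤a , p∤b ]′ (euclidsLemma ∣ a ∣ ∣ b ∣ p-prime (subst (p ∣_) (ℤ.abs-* a b) p∣ab))

  ∤-+∣ : ∀ a b → p ∤ ∣ a ∣ → p ∣ ∣ b ∣ → p ∤ ∣ a + b ∣
  ∤-+∣ a b p∤a p∣b p∣a+b =
    p∤a (Signed.∣⇒∣ᵤ (Signed.∣m+n∣n⇒∣m {+ p} {a} {b} (Signed.∣ᵤ⇒∣ p∣a+b) (Signed.∣ᵤ⇒∣ p∣b)))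

  -- Val≥ᵘ x u l: x = (num / den) · p^u / p^l with p ∤ den, i.e. ν_p(x) ≥ u − l. The
  -- exponent is kept as a difference of naturals to avoid integer powers.
  record Val≥ᵘ (x : ℚᵘ) (u l : ℕ) : Set where
    constructor val≥ᵘ
    field
      num den : ℤ
      den-unit : p ∤ ∣ den ∣
      scaled : ↥ x * den * p^ l ≡ num * p^ u * ↧ x

  record Val≡ᵘ (x : ℚᵘ) (u l : ℕ) : Set where
    constructor val≡ᵘ
    field
      val≥ : Val≥ᵘ x u l
      num-unit : p ∤ ∣ Val≥ᵘ.num val≥ ∣

  Val≥ᵘ-cong : ∀ {x y u l} → x ℚᵘ.≃ y → Val≥ᵘ x u l → Val≥ᵘ y u l
  Val≥ᵘ-cong {x} {y} {u} {l} x≃y (val≥ᵘ r s s-unit eq) =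
    val≥ᵘ r s s-unit (ℤ.*-cancelʳ-≡ _ _ (↧ x) (begin
      ↥ y * s * p^ l * ↧ x    ≡⟨ regroup (↥ y) s (p^ l) (↧ x) ⟩
      ↥ y * ↧ x * (s * p^ l)  ≡⟨ cong (_* (s * p^ l)) (sym (ℚᵘ.drop-*≡* x≃y)) ⟩
      ↥ x * ↧ y * (s * p^ l)  ≡⟨ sym (regroup (↥ x) s (p^ l) (↧ y)) ⟩
      ↥ x * s * p^ l * ↧ y    ≡⟨ cong (_* ↧ y) eq ⟩
      r * p^ u * ↧ x * ↧ y    ≡⟨ swap-last r (p^ u) (↧ x) (↧ y) ⟩
      r * p^ u * ↧ y * ↧ x    ∎))
    where
    open ≡-Reasoning
    regroup : ∀ a b c d → a * b * c * d ≡ a * d * (b * c)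
    regroup = solve-∀
    swap-last : ∀ a b c d → a * b * c * d ≡ a * b * d * c
    swap-last = solve-∀

  Val≡ᵘ-cong : ∀ {x y u l} → x ℚᵘ.≃ y → Val≡ᵘ x u l → Val≡ᵘ y u l
  Val≡ᵘ-cong x≃y (val≡ᵘ v unit) = val≡ᵘ (Val≥ᵘ-cong x≃y v) unit

  Val≥ᵘ-weaken : ∀ {x u l u′ l′} D → u′ ℕ.+ l ℕ.+ D ≡ u ℕ.+ l′ → Val≥ᵘ x u l → Val≥ᵘ x u′ l′
  Val≥ᵘ-weaken {x} {u} {l} {u′} {l′} D balance (val≥ᵘ r s s-unit eq) =
    val≥ᵘ (r * p^ D) s s-unit (ℤ.*-cancelʳ-≡ _ _ (p^ l) {{p^-nonZero l}} (begin
      ↥ x * s * p^ l′ * p^ l           ≡⟨ swap-last (↥ x) s (p^ l) (p^ l′) ⟩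
      ↥ x * s * p^ l * p^ l′           ≡⟨ cong (_* p^ l′) eq ⟩
      r * p^ u * ↧ x * p^ l′           ≡⟨ regroup r (↧ x) (p^ u) (p^ l′) ⟩
      r * ↧ x * (p^ u * p^ l′)         ≡⟨ cong (r * ↧ x *_) (sym (p^-+ u l′)) ⟩
      r * ↧ x * p^ (u ℕ.+ l′)          ≡⟨ cong (λ k → r * ↧ x * p^ k) (sym balance) ⟩
      r * ↧ x * p^ (u′ ℕ.+ l ℕ.+ D)    ≡⟨ cong (r * ↧ x *_) split ⟩
      r * ↧ x * (p^ u′ * p^ l * p^ D)  ≡⟨ regroup′ r (↧ x) (p^ u′) (p^ l) (p^ D) ⟩
      r * p^ D * p^ u′ * ↧ x * p^ l    ∎))
    where
    open ≡-Reasoning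
    split : p^ (u′ ℕ.+ l ℕ.+ D) ≡ p^ u′ * p^ l * p^ D
    split = trans (p^-+ (u′ ℕ.+ l) D) (cong (_* p^ D) (p^-+ u′ l))
    swap-last : ∀ a b c d → a * b * d * c ≡ a * b * c * d
    swap-last = solve-∀
    regroup : ∀ a b c d → a * c * b * d ≡ a * b * (c * d)
    regroup = solve-∀
    regroup′ : ∀ a b c d e → a * b * (c * d * e) ≡ a * e * c * b * d
    regroup′ = solve-∀

  Val≥ᵘ-+ : ∀ {x y u l} → Val≥ᵘ x u l → Val≥ᵘ y u l → Val≥ᵘ (x ℚᵘ.+ y) u l
  Val≥ᵘ-+ {x@(mkℚᵘ _ _)} {y@(mkℚᵘ _ _)} {u} {l} (val≥ᵘ r s s-unit eq) (val≥ᵘ r′ s′ s′-unit eq′) =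
    val≥ᵘ (r * s′ + r′ * s) (s * s′) (∤-* s s′ s-unit s′-unit) (begin
      (↥ x * ↧ y + ↥ y * ↧ x) * (s * s′) * p^ l
        ≡⟨ expand (↥ x) (↥ y) s s′ (p^ l) (↧ x) (↧ y) ⟩
      (↥ x * s * p^ l) * (s′ * ↧ y) + (↥ y * s′ * p^ l) * (s * ↧ x)
        ≡⟨ cong₂ (λ a b → a * (s′ * ↧ y) + b * (s * ↧ x)) eq eq′ ⟩
      (r * p^ u * ↧ x) * (s′ * ↧ y) + (r′ * p^ u * ↧ y) * (s * ↧ x)
        ≡⟨ collect r r′ s s′ (p^ u) (↧ x) (↧ y) ⟩
      (r * s′ + r′ * s) * p^ u * (↧ x * ↧ y) ∎)
    where
    open ≡-Reasoning
    expand : ∀ n m s s′ P dx dy →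
      (n * dy + m * dx) * (s * s′) * P ≡ (n * s * P) * (s′ * dy) + (m * s′ * P) * (s * dx)
    expand = solve-∀
    collect : ∀ r r′ s s′ P dx dy →
      (r * P * dx) * (s′ * dy) + (r′ * P * dy) * (s * dx) ≡ (r * s′ + r′ * s) * P * (dx * dy)
    collect = solve-∀

  Val≥ᵘ-* : ∀ {x y u l u′ l′} → Val≥ᵘ x u l → Val≥ᵘ y u′ l′ → Val≥ᵘ (x ℚᵘ.* y) (u ℕ.+ u′) (l ℕ.+ l′)
  Val≥ᵘ-* {x@(mkℚᵘ _ _)} {y@(mkℚᵘ _ _)} {u} {l} {u′} {l′} (val≥ᵘ r s s-unit eq) (val≥ᵘ r′ s′ s′-unit eq′) =
    val≥ᵘ (r * r′) (s * s′) (∤-* s s′ s-unit s′-unit) (begin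
      ↥ x * ↥ y * (s * s′) * p^ (l ℕ.+ l′)   ≡⟨ cong (↥ x * ↥ y * (s * s′) *_) (p^-+ l l′) ⟩
      ↥ x * ↥ y * (s * s′) * (p^ l * p^ l′)  ≡⟨ interchange (↥ x) (↥ y) s s′ (p^ l) (p^ l′) ⟩
      (↥ x * s * p^ l) * (↥ y * s′ * p^ l′)  ≡⟨ cong₂ _*_ eq eq′ ⟩
      (r * p^ u * ↧ x) * (r′ * p^ u′ * ↧ y)  ≡⟨ sym (interchange r r′ (p^ u) (p^ u′) (↧ x) (↧ y)) ⟩
      r * r′ * (p^ u * p^ u′) * (↧ x * ↧ y)  ≡⟨ cong (λ P → r * r′ * P * (↧ x * ↧ y)) (sym (p^-+ u u′)) ⟩
      r * r′ * p^ (u ℕ.+ u′) * (↧ x * ↧ y)   ∎)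
    where
    open ≡-Reasoning
    interchange : ∀ a b c d e f → a * b * (c * d) * (e * f) ≡ (a * c * e) * (b * d * f)
    interchange = solve-∀

  Val≡ᵘ-* : ∀ {x y u l u′ l′} → Val≡ᵘ x u l → Val≡ᵘ y u′ l′ → Val≡ᵘ (x ℚᵘ.* y) (u ℕ.+ u′) (l ℕ.+ l′)
  Val≡ᵘ-* {mkℚᵘ _ _} {mkℚᵘ _ _} (val≡ᵘ v unit) (val≡ᵘ v′ unit′) =
    val≡ᵘ (Val≥ᵘ-* v v′) (∤-* (Val≥ᵘ.num v) (Val≥ᵘ.num v′) unit unit′)

  -- Rewritten at level u, the higher-valuation summand y gets a numerator divisible by p.
  Val≡ᵘ-+ : ∀ {x y u l} → Val≡ᵘ x u l → Val≥ᵘ y (suc u) l → Val≡ᵘ (x ℚᵘ.+ y) u l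
  Val≡ᵘ-+ {mkℚᵘ _ _} {mkℚᵘ _ _} {u} {l} (val≡ᵘ v@(val≥ᵘ r s _ _) unit) w@(val≥ᵘ r′ s′ s′-unit _) =
    val≡ᵘ (Val≥ᵘ-+ v (Val≥ᵘ-weaken 1 (ℕ.+-comm (u ℕ.+ l) 1) w))
          (∤-+∣ (r * s′) (r′ * p^ 1 * s) (∤-* r s′ unit s′-unit) p∣r′ps)
    where
    p∣r′ps : p ∣ ∣ r′ * p^ 1 * s ∣
    p∣r′ps = Signed.∣⇒∣ᵤ (Signed.∣m⇒∣m*n s (Signed.∣n⇒∣m*n r′ (Signed.∣ᵤ⇒∣ {+ p} {p^ 1} (m∣m*n 1))))

  Val≡ᵘ-≢0 : ∀ {x u l} → Val≡ᵘ x u l → ↥ x ≢ 0ℤ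
  Val≡ᵘ-≢0 {x} {u} {l} (val≡ᵘ (val≥ᵘ r s _ eq) unit) ↥x≡0 =
    unit (subst (λ r → p ∣ ∣ r ∣) (sym r≡0) (p ∣0))
    where
    open ≡-Reasoning
    r≡0 : r ≡ 0ℤ
    r≡0 = ℤ.*-cancelʳ-≡ r 0ℤ (p^ u) {{p^-nonZero u}} (ℤ.*-cancelʳ-≡ _ _ (↧ x) (begin
      r * p^ u * ↧ x   ≡⟨ sym eq ⟩
      ↥ x * s * p^ l   ≡⟨ cong (λ n → n * s * p^ l) ↥x≡0 ⟩
      0ℤ               ∎))

  mkℚᵘ-val≥ : ∀ n d → Val≥ᵘ (mkℚᵘ n d) 0 (νℕ p (suc d))
  mkℚᵘ-val≥ n d =
    let w , d≡ , p∤w = νℕ-factorisation p-prime {suc d} (s≤s z≤n)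
    in val≥ᵘ n (+ w) p∤w (begin
      n * + w * p^ l          ≡⟨ regroup n (+ w) (p^ l) ⟩
      n * + 1 * (p^ l * + w)  ≡⟨ cong (n * + 1 *_) (sym (trans (cong +_ d≡) (ℤ.pos-* (p ^ l) w))) ⟩
      n * + 1 * + suc d       ∎)
    where
    open ≡-Reasoning
    l : ℕ
    l = νℕ p (suc d)
    regroup : ∀ a b c → a * b * c ≡ a * + 1 * (c * b)
    regroup = solve-∀

  ℤ-factorisation : ∀ z → z ≢ 0ℤ → ∃ λ r → z ≡ r * p^ (ν p z) × p ∤ ∣ r ∣
  ℤ-factorisation (+ n) z≢0 =
    let w , n≡ , p∤w = νℕ-factorisation p-prime (∣∣>0 z≢0)
    in + w , trans (cong +_ n≡) (trans (ℤ.pos-* (p ^ νℕ p n) w) (ℤ.*-comm (p^ νℕ p n) (+ w))) , p∤w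
  ℤ-factorisation -[1+ n ] _ =
    let r , n≡ , p∤r = ℤ-factorisation (+ suc n) λ ()
    in - r , trans (cong -_ n≡) (ℤ.neg-distribˡ-* r (p^ νℕ p (suc n))) ,
       subst (p ∤_) (sym (ℤ.∣-i∣≡∣i∣ r)) p∤r

  record Val≥ (x : ℚ) (u l : ℕ) : Set where
    constructor val≥
    field unnormalised : Val≥ᵘ (ℚ.toℚᵘ x) u l

  record Val≡ (x : ℚ) (u l : ℕ) : Set where
    constructor val≡
    field unnormalised : Val≡ᵘ (ℚ.toℚᵘ x) u l

  Val≡⇒Val≥ : ∀ {x u l} → Val≡ x u l → Val≥ x u l
  Val≡⇒Val≥ (val≡ (val≡ᵘ v _)) = val≥ v

  Val≡-≢0 : ∀ {x u l} → Val≡ x u l → x ≢ ℚ.0ℚ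
  Val≡-≢0 (val≡ v) refl = Val≡ᵘ-≢0 v refl

  Val≥-0 : ∀ {u l} → Val≥ ℚ.0ℚ u l
  Val≥-0 = val≥ (val≥ᵘ 0ℤ (+ 1) ∤1 refl)

  Val≡-1 : Val≡ ℚ.1ℚ 0 0
  Val≡-1 = val≡ (val≡ᵘ (val≥ᵘ (+ 1) (+ 1) ∤1 refl) ∤1)

  Val≥-weaken : ∀ {x u l u′ l′} → u′ ℕ.+ l ≤ u ℕ.+ l′ → Val≥ x u l → Val≥ x u′ l′
  Val≥-weaken le (val≥ v) = val≥ (Val≥ᵘ-weaken _ (ℕ.m+[n∸m]≡n le) v)

  Val≥-+ : ∀ {x y u l} → Val≥ x u l → Val≥ y u l → Val≥ (x ℚ.+ y) u l
  Val≥-+ {x} {y} (val≥ v) (val≥ w) = val≥ (Val≥ᵘ-cong (ℚᵘ.≃-sym (ℚ.toℚᵘ-homo-+ x y)) (Val≥ᵘ-+ v w))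

  Val≥-* : ∀ {x y u l u′ l′} → Val≥ x u l → Val≥ y u′ l′ → Val≥ (x ℚ.* y) (u ℕ.+ u′) (l ℕ.+ l′)
  Val≥-* {x} {y} (val≥ v) (val≥ w) = val≥ (Val≥ᵘ-cong (ℚᵘ.≃-sym (ℚ.toℚᵘ-homo-* x y)) (Val≥ᵘ-* v w))

  Val≡-* : ∀ {x y u l u′ l′} → Val≡ x u l → Val≡ y u′ l′ → Val≡ (x ℚ.* y) (u ℕ.+ u′) (l ℕ.+ l′)
  Val≡-* {x} {y} (val≡ v) (val≡ w) = val≡ (Val≡ᵘ-cong (ℚᵘ.≃-sym (ℚ.toℚᵘ-homo-* x y)) (Val≡ᵘ-* v w))

  Val≡-+ˡ : ∀ {x y u l} → Val≡ x u l → Val≥ y (suc u) l → Val≡ (x ℚ.+ y) u l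
  Val≡-+ˡ {x} {y} (val≡ v) (val≥ w) = val≡ (Val≡ᵘ-cong (ℚᵘ.≃-sym (ℚ.toℚᵘ-homo-+ x y)) (Val≡ᵘ-+ v w))

  Val≡-+ʳ : ∀ {x y u l} → Val≥ x (suc u) l → Val≡ y u l → Val≡ (x ℚ.+ y) u l
  Val≡-+ʳ {x} {y} v w = subst (λ z → Val≡ z _ _) (ℚ.+-comm y x) (Val≡-+ˡ w v)

  ℤ-val≥ : ∀ z → Val≥ (z ℚ./ 1) 0 0
  ℤ-val≥ z = val≥ (Val≥ᵘ-cong (ℚᵘ.≃-sym (ℚ.toℚᵘ-fromℚᵘ (mkℚᵘ z 0))) (val≥ᵘ z (+ 1) ∤1 refl))

  ℤ-val≡ : ∀ z → z ≢ 0ℤ → Val≡ (z ℚ./ 1) (ν p z) 0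
  ℤ-val≡ z z≢0 =
    let r , z≡ , p∤r = ℤ-factorisation z z≢0
    in val≡ (Val≡ᵘ-cong (ℚᵘ.≃-sym (ℚ.toℚᵘ-fromℚᵘ (mkℚᵘ z 0)))
         (val≡ᵘ (val≥ᵘ r (+ 1) ∤1 (cong (_* + 1) (trans (ℤ.*-identityʳ z) z≡))) p∤r))

  frac-val≥ : ∀ b a → a ≢ 0ℤ → Val≥ (frac b a) 0 (ν p a)
  frac-val≥ b a a≢0 =
    let n , d , frac≃ , _ , d≡a = frac-≃ b a a≢0
    in subst (λ m → Val≥ (frac b a) 0 (νℕ p m)) d≡a
         (val≥ (Val≥ᵘ-cong (ℚᵘ.≃-sym frac≃) (mkℚᵘ-val≥ n d)))

  frac-val≡ : ∀ b a → a ≢ 0ℤ → p ∤ ∣ b ∣ → Val≡ (frac b a) 0 (ν p a)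
  frac-val≡ b a a≢0 p∤b =
    let n , d , frac≃ , n≡b , d≡a = frac-≃ b a a≢0
    in subst (λ m → Val≡ (frac b a) 0 (νℕ p m)) d≡a
         (val≡ (Val≡ᵘ-cong (ℚᵘ.≃-sym frac≃) (val≡ᵘ (mkℚᵘ-val≥ n d) (subst (p ∤_) (sym n≡b) p∤b))))

  sumTo-val≥ : ∀ {f u l} N → (∀ n → 1 ≤ n → n ≤ N → Val≥ (f n) u l) → Val≥ (sumTo f N) u l
  sumTo-val≥ zero _ = Val≥-0
  sumTo-val≥ (suc N) terms =
    Val≥-+ (sumTo-val≥ N λ n 1≤n n≤N → terms n 1≤n (ℕ.m≤n⇒m≤1+n n≤N)) (terms (suc N) (s≤s z≤n) ℕ.≤-refl)

  sumTo-val≡ : ∀ {f u l} N n₀ → 1 ≤ n₀ → n₀ ≤ N → Val≡ (f n₀) u l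
    → (∀ n → 1 ≤ n → n ≤ N → n ≢ n₀ → Val≥ (f n) (suc u) l) → Val≡ (sumTo f N) u l
  sumTo-val≡ zero n₀ 1≤n₀ n₀≤0 _ _ = contradiction (ℕ.≤-trans 1≤n₀ n₀≤0) λ ()
  sumTo-val≡ (suc N) n₀ 1≤n₀ n₀≤N+1 exact others with n₀ ℕ.≟ suc N
  ... | yes refl =
    Val≡-+ʳ (sumTo-val≥ N λ n 1≤n n≤N → others n 1≤n (ℕ.m≤n⇒m≤1+n n≤N) λ { refl → ℕ.<-irrefl refl n≤N })
            exact
  ... | no n₀≢N+1 =
    Val≡-+ˡ (sumTo-val≡ N n₀ 1≤n₀ (ℕ.≤-pred (ℕ.≤∧≢⇒< n₀≤N+1 n₀≢N+1)) exact
               λ n 1≤n n≤N → others n 1≤n (ℕ.m≤n⇒m≤1+n n≤N))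
            (others (suc N) (s≤s z≤n) ℕ.≤-refl (n₀≢N+1 ∘ sym))

  sumℚ-val≥ : ∀ {A : Set} {u l} (T : A → ℚ) L → (∀ e → e ∈ L → Val≥ (T e) u l)
    → Val≥ (sumℚ (map T L)) u l
  sumℚ-val≥ T [] _ = Val≥-0
  sumℚ-val≥ T (x ∷ L) terms = Val≥-+ (terms x (here refl)) (sumℚ-val≥ T L λ e e∈L → terms e (there e∈L))

  sumℚ-val≡ : ∀ {A : Set} {u l} (T : A → ℚ) {L} e₀ → Unique L → e₀ ∈ L → Val≡ (T e₀) u l
    → (∀ e → e ∈ L → e ≢ e₀ → Val≥ (T e) (suc u) l) → Val≡ (sumℚ (map T L)) u l
  sumℚ-val≡ T {x ∷ L} _ (x∉L ∷ _) (here refl) exact others =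
    Val≡-+ˡ exact (sumℚ-val≥ T L λ e e∈L → others e (there e∈L) λ e≡x → All.lookup x∉L e∈L (sym e≡x))
  sumℚ-val≡ T {x ∷ L} e₀ (x∉L ∷ unique) (there e₀∈L) exact others =
    Val≡-+ʳ (others x (here refl) (All.lookup x∉L e₀∈L))
            (sumℚ-val≡ T e₀ unique e₀∈L exact λ e e∈L → others e (there e∈L))

  powℚ-val≡ : ∀ {x l} → Val≡ x 0 l → ∀ e → Val≡ (powℚ x e) 0 (e ℕ.* l)
  powℚ-val≡ v zero = Val≡-1
  powℚ-val≡ v (suc e) = Val≡-* v (powℚ-val≡ v e)

  α-val≡ : ∀ (A B : ℕ → ℤ) N n₀
    → (∀ n → 1 ≤ n → n ≤ N → A n ≢ 0ℤ)
    → (∀ n → 1 ≤ n → n ≤ N → p ∤ gcd ∣ B n ∣ ∣ A n ∣)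
    → UniqueArgmax (ν p ∘ A) N n₀
    → 1 ≤ maxUpTo (ν p ∘ A) N
    → Val≡ (sumTo (λ n → frac (B n) (A n)) N) 0 (maxUpTo (ν p ∘ A) N)
  α-val≡ A B N n₀ A≢0 coprime (1≤n₀ , n₀≤N , argmax , unique) 1≤max =
    sumTo-val≡ N n₀ 1≤n₀ n₀≤N exact others
    where
    p∣A : p ∣ ∣ A n₀ ∣
    p∣A = νℕ>0⇒∣ p-prime (∣∣>0 (A≢0 n₀ 1≤n₀ n₀≤N)) (subst (1 ≤_) (sym argmax) 1≤max)
    exact : Val≡ (frac (B n₀) (A n₀)) 0 (maxUpTo (ν p ∘ A) N)
    exact = subst (Val≡ _ 0) argmax
      (frac-val≡ (B n₀) (A n₀) (A≢0 n₀ 1≤n₀ n₀≤N) λ p∣B → coprime n₀ 1≤n₀ n₀≤N (gcd-greatest p∣B p∣A))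
    others : ∀ n → 1 ≤ n → n ≤ N → n ≢ n₀ → Val≥ (frac (B n) (A n)) 1 (maxUpTo (ν p ∘ A) N)
    others n 1≤n n≤N n≢n₀ = Val≥-weaken below-max (frac-val≥ (B n) (A n) (A≢0 n 1≤n n≤N))
      where
      below-max : 1 ℕ.+ ν p (A n) ≤ maxUpTo (ν p ∘ A) N
      below-max = ℕ.≤∧≢⇒< (≤-maxUpTo (ν p ∘ A) 1≤n n≤N) (n≢n₀ ∘ unique n 1≤n n≤N)

open import Data.Nat using (_+_; _*_; _⊔_)

data _<colex_ : ∀ {n} → Vec ℕ n → Vec ℕ n → Set where
  tail< : ∀ {n x y} {xs ys : Vec ℕ n} → xs <colex ys → (x ∷ xs) <colex (y ∷ ys)
  head< : ∀ {n x y} {xs : Vec ℕ n} → x < y → (x ∷ xs) <colex (y ∷ xs)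

colex-trans : ∀ {n} {xs ys zs : Vec ℕ n} → xs <colex ys → ys <colex zs → xs <colex zs
colex-trans (tail< xs<ys) (tail< ys<zs) = tail< (colex-trans xs<ys ys<zs)
colex-trans (tail< xs<ys) (head< _) = tail< xs<ys
colex-trans (head< _) (tail< ys<zs) = tail< ys<zs
colex-trans (head< x<y) (head< y<z) = head< (ℕ.<-trans x<y y<z)

colex-compare : ∀ {n} (xs ys : Vec ℕ n) → (xs ≡ ys ⊎ xs <colex ys) ⊎ ys <colex xs
colex-compare [] [] = inj₁ (inj₁ refl)
colex-compare (x ∷ xs) (y ∷ ys) with colex-compare xs ys
... | inj₂ ys<xs = inj₂ (tail< ys<xs)
... | inj₁ (inj₂ xs<ys) = inj₁ (inj₂ (tail< xs<ys))
... | inj₁ (inj₁ refl) with ℕ.<-cmp x y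
...   | tri< x<y _ _ = inj₁ (inj₂ (head< x<y))
...   | tri≈ _ refl _ = inj₁ (inj₁ refl)
...   | tri> _ _ y<x = inj₂ (head< y<x)

weight : ∀ {K} → Vec ℕ K → (ℕ → ℕ) → ℕ
weight [] M = 0
weight (e ∷ es) M = e * M 1 + weight es (M ∘ suc)

-- W ≤ t · M 0 bounds the weight of coordinates already passed, whose degree t counts
-- against d.
weight-<colex : ∀ {K} C d → 1 ≤ d → (M : ℕ → ℕ) → (∀ j → j < K → C + d * M j < M (suc j))
  → (e e′ : Vec ℕ K) (t W : ℕ) → W ≤ t * M 0 → t + deg e ≤ d → e <colex e′
  → C + W + weight e M < weight e′ M
weight-<colex C d 1≤d M growth (x ∷ xs) (y ∷ ys) t W W≤ deg≤ (tail< xs<ys) = begin-strict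
    C + W + (x * M 1 + weight xs (M ∘ suc))  ≡⟨ reassoc C W (x * M 1) (weight xs (M ∘ suc)) ⟩
    C + (W + x * M 1) + weight xs (M ∘ suc)  <⟨ weight-<colex C d 1≤d (M ∘ suc) growth′ xs ys
                                                  (t + x) (W + x * M 1) W′≤ deg′≤ xs<ys ⟩
    weight ys (M ∘ suc)                     ≤⟨ ℕ.m≤n+m (weight ys (M ∘ suc)) (y * M 1) ⟩
    y * M 1 + weight ys (M ∘ suc)            ∎
  where
  open ℕ.≤-Reasoning
  reassoc : ∀ a b c e → a + b + (c + e) ≡ a + (b + c) + e
  reassoc = solveℕ-∀
  growth′ : ∀ j → j < _ → C + d * M (suc j) < M (suc (suc j))
  growth′ j j<K = growth (suc j) (s≤s j<K)
  M0≤M1 : M 0 ≤ M 1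
  M0≤M1 = ℕ.≤-trans (ℕ.m≤n*m (M 0) d {{ℕ.>-nonZero 1≤d}})
                    (ℕ.≤-trans (ℕ.m≤n+m (d * M 0) C) (ℕ.<⇒≤ (growth 0 (s≤s z≤n))))
  W′≤ : W + x * M 1 ≤ (t + x) * M 1
  W′≤ = ℕ.≤-trans (ℕ.+-monoˡ-≤ (x * M 1) (ℕ.≤-trans W≤ (ℕ.*-monoʳ-≤ t M0≤M1)))
                  (ℕ.≤-reflexive (sym (ℕ.*-distribʳ-+ (M 1) t x)))
  deg′≤ : t + x + deg xs ≤ d
  deg′≤ = ℕ.≤-trans (ℕ.≤-reflexive (ℕ.+-assoc t x (deg xs))) deg≤
weight-<colex C d _ M growth (x ∷ xs) (y ∷ xs) t W W≤ deg≤ (head< x<y) = begin-strict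
    C + W + (x * M 1 + weight xs (M ∘ suc))  ≡⟨ sym (ℕ.+-assoc (C + W) (x * M 1) (weight xs (M ∘ suc))) ⟩
    C + W + x * M 1 + weight xs (M ∘ suc)    <⟨ ℕ.+-monoˡ-< (weight xs (M ∘ suc)) head-< ⟩
    y * M 1 + weight xs (M ∘ suc)            ∎
  where
  open ℕ.≤-Reasoning
  C+W<M1 : C + W < M 1
  C+W<M1 = ℕ.≤-<-trans (ℕ.+-monoʳ-≤ C (ℕ.≤-trans W≤ (ℕ.*-monoˡ-≤ (M 0) t≤d))) (growth 0 (s≤s z≤n))
    where
    t≤d : t ≤ d
    t≤d = ℕ.≤-trans (ℕ.m≤m+n t (deg (x ∷ xs))) deg≤
  head-< : C + W + x * M 1 < y * M 1
  head-< = ℕ.<-≤-trans (ℕ.+-monoˡ-< (x * M 1) C+W<M1) (ℕ.*-monoˡ-≤ (M 1) x<y)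

∈-exps : ∀ K d (e : Vec ℕ K) → deg e ≤ d → e ∈ exps K d
∈-exps zero d [] _ = here refl
∈-exps (suc K) d (i ∷ es) deg≤ =
  ∈-concat⁺′ (∈-map⁺ (i ∷_) (∈-exps K d es (ℕ.≤-trans (ℕ.m≤n+m (deg es) i) deg≤)))
             (∈-map⁺ (λ j → map (j ∷_) (exps K d)) (∈-upTo⁺ (s≤s (ℕ.≤-trans (ℕ.m≤m+n i (deg es)) deg≤))))

exps-unique : ∀ K d → Unique (exps K d)
exps-unique zero d = All.[] ∷ []
exps-unique (suc K) d =
  Unique.concat⁺ (All.map⁺ (All.tabulate λ _ → Unique.map⁺ ∷-injectiveʳ (exps-unique K d)))
                 (AllPairs.map⁺ (AllPairs.map disjoint (Unique.upTo⁺ (suc d))))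
  where
  disjoint : ∀ {i j} → i ≢ j → Disjoint (map (i ∷_) (exps K d)) (map (j ∷_) (exps K d))
  disjoint i≢j (v∈i , v∈j) with ∈-map⁻ (_ ∷_) v∈i | ∈-map⁻ (_ ∷_) v∈j
  ... | _ , _ , refl | _ , _ , i∷≡j∷ = i≢j (∷-injectiveˡ i∷≡j∷)

colex-max : ∀ {K} (P : Vec ℕ K → Set) → Decidable P → (L : List (Vec ℕ K))
  → (∃ λ m → m ∈ L × P m × ∀ e → e ∈ L → P e → e ≡ m ⊎ e <colex m) ⊎ (∀ e → e ∈ L → ¬ P e)
colex-max P P? [] = inj₂ λ _ ()
colex-max P P? (x ∷ L) with P? x | colex-max P P? L
... | no ¬Px | inj₂ none = inj₂ λ { e (here refl) → ¬Px ; e (there e∈L) → none e e∈L }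
... | no ¬Px | inj₁ (m , m∈L , Pm , max) =
  inj₁ (m , there m∈L , Pm , λ { e (here refl) Pe → contradiction Pe ¬Px ; e (there e∈L) → max e e∈L })
... | yes Px | inj₂ none =
  inj₁ (x , here refl , Px , λ { e (here refl) _ → inj₁ refl ; e (there e∈L) Pe → contradiction Pe (none e e∈L) })
... | yes Px | inj₁ (m , m∈L , Pm , max) with colex-compare x m
...   | inj₁ x≤m = inj₁ (m , there m∈L , Pm , λ { e (here refl) _ → x≤m ; e (there e∈L) → max e e∈L })
...   | inj₂ m<x =
  inj₁ (x , here refl , Px , λ { e (here refl) _ → inj₁ refl ; e (there e∈L) Pe → inj₂ (≤-< (max e e∈L Pe) m<x) })
  where
  ≤-< : ∀ {e} → e ≡ m ⊎ e <colex m → m <colex x → e <colex x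
  ≤-< (inj₁ refl) m<x = m<x
  ≤-< (inj₂ e<m) m<x = colex-trans e<m m<x

module _ (p : ℕ) (p-prime : Prime p) where

  open Valuation p p-prime

  monomial-val≡ : ∀ {K} (A : ℕ → ℚ) (M : ℕ → ℕ) → (∀ k → 1 ≤ k → k ≤ K → Val≡ (A k) 0 (M k))
    → (e : Vec ℕ K) → Val≡ (monomial e (tabulate λ i → A (suc (toℕ i)))) 0 (weight e M)
  monomial-val≡ A M exact [] = Val≡-1
  monomial-val≡ A M exact (k ∷ es) =
    Val≡-* (powℚ-val≡ (exact 1 ℕ.≤-refl (s≤s z≤n)) k)
           (monomial-val≡ (A ∘ suc) (M ∘ suc) (λ k 1≤k k≤K → exact (suc k) (s≤s z≤n) (s≤s k≤K)) es)

  evalPoly-≢0 : ∀ K d → 1 ≤ d → (c : Vec ℕ K → ℤ) → (∀ e → d < deg e → c e ≡ 0ℤ)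
    → (e* : Vec ℕ K) → c e* ≢ 0ℤ → (∀ e → e ∈ exps K d → c e ≢ 0ℤ → e ≡ e* ⊎ e <colex e*)
    → (A : ℕ → ℚ) (M : ℕ → ℕ) → (∀ k → 1 ≤ k → k ≤ K → Val≡ (A k) 0 (M k))
    → (∀ j → j < K → ν p (c e*) + d * M j < M (suc j))
    → evalPoly K d c (tabulate λ i → A (suc (toℕ i))) ≢ ℚ.0ℚ
  evalPoly-≢0 K d 1≤d c deg-bound e* c*≢0 leading A M exact growth =
    Val≡-≢0 (sumℚ-val≡ term e* (exps-unique K d) (∈-exps K d e* (deg≤ c*≢0)) leading-term other-term)
    where
    x : Vec ℚ K
    x = tabulate λ i → A (suc (toℕ i))
    term : Vec ℕ K → ℚ
    term e = (c e ℚ./ 1) ℚ.* monomial e x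
    deg≤ : ∀ {e} → c e ≢ 0ℤ → deg e ≤ d
    deg≤ {e} ce≢0 = ℕ.≮⇒≥ (ce≢0 ∘ deg-bound e)
    leading-term : Val≡ (term e*) (ν p (c e*) + 0) (weight e* M)
    leading-term = Val≡-* (ℤ-val≡ (c e*) c*≢0) (monomial-val≡ A M exact e*)
    other-term : ∀ e → e ∈ exps K d → e ≢ e* → Val≥ (term e) (suc (ν p (c e*) + 0)) (weight e* M)
    other-term e e∈exps e≢e* with c e ℤ.≟ 0ℤ
    ... | yes ce≡0 = subst (λ y → Val≥ y _ _) (sym term≡0) Val≥-0
      where
      term≡0 : term e ≡ ℚ.0ℚ
      term≡0 = trans (cong (λ z → (z ℚ./ 1) ℚ.* monomial e x) ce≡0) (ℚ.*-zeroˡ (monomial e x))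
    ... | no ce≢0 with leading e e∈exps ce≢0
    ...   | inj₁ e≡e* = contradiction e≡e* e≢e*
    ...   | inj₂ e<e* =
      Val≥-weaken (weight-<colex (ν p (c e*)) d 1≤d M growth e e* 0 0 z≤n (deg≤ ce≢0) e<e*)
                  (Val≥-* (ℤ-val≥ (c e)) (Val≡⇒Val≥ (monomial-val≡ A M exact e)))

Eventually : (ℕ → Set) → Set
Eventually P = ∃ λ N₀ → ∀ N → N₀ ≤ N → P N

eventually-∀< : ∀ {R : ℕ → ℕ → Set} n → (∀ j → j < n → Eventually (R j))
  → Eventually λ N → ∀ j → j < n → R j N
eventually-∀< zero _ = 0 , λ _ _ _ ()
eventually-∀< {R} (suc n) eventually
  with eventually-∀< n (λ j j<n → eventually j (ℕ.m≤n⇒m≤1+n j<n)) | eventually n ℕ.≤-refl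
... | N₁ , below-n | N₂ , at-n = N₁ ⊔ N₂ , all
  where
  all : ∀ N → N₁ ⊔ N₂ ≤ N → ∀ j → j < suc n → R j N
  all N N₀≤N j j<n+1 with ℕ.m≤n⇒m<n∨m≡n (ℕ.≤-pred j<n+1)
  ... | inj₁ j<n = below-n N (ℕ.≤-trans (ℕ.m≤m⊔n N₁ N₂) N₀≤N) j j<n
  ... | inj₂ refl = at-n N (ℕ.≤-trans (ℕ.m≤n⊔m N₁ N₂) N₀≤N)

maxν : ℕ → (ℕ → ℕ → ℤ) → ℕ → ℕ → ℕ
maxν p a k = maxUpTo λ n → ν p (ext a k n)

Growth : ℕ → (ℕ → ℕ → ℤ) → ℕ → ℕ → ℕ → ℕ → Set
Growth p a d C K N = ∀ j → j < K → C + d * maxν p a j N < maxν p a (suc j) N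

prime-with-growth : ∀ K d (a : ℕ → ℕ → ℤ) (𝒫 : ℕ → Set) → (∀ p → 𝒫 p → Prime p)
  → ((∃ λ p → ∀ q → 𝒫 q ⇔ (q ≡ p)) ⊎ (∀ B → ∃ λ q → B < q × 𝒫 q))
  → (∀ p j → 𝒫 p → suc j ≤ K → Eventually λ N → d * maxν p a j N < maxν p a (suc j) N)
  → (∀ p → (∀ q → 𝒫 q ⇔ (q ≡ p)) → ∀ j → suc j ≤ K → ∀ C
       → Eventually λ N → C + d * maxν p a j N < maxν p a (suc j) N)
  → ∀ z → z ≢ 0ℤ → ∃ λ p → 𝒫 p × Eventually (Growth p a d (ν p z) K)
prime-with-growth K d a 𝒫 _ (inj₁ (p , 𝒫≡p)) _ grow-single z _ =
  p , Equivalence.from (𝒫≡p p) refl , eventually-∀< K λ j j<K → grow-single p 𝒫≡p j j<K (ν p z)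
prime-with-growth K d a 𝒫 𝒫⇒prime (inj₂ unbounded) grow _ z z≢0 with unbounded ∣ z ∣
... | q , ∣z∣<q , 𝒫q =
  q , 𝒫q , subst (λ C → Eventually (Growth q a d C K)) (sym νz≡0) (eventually-∀< K λ j j<K → grow q j 𝒫q j<K)
  where
  q∤z : q ∤ ∣ z ∣
  q∤z q∣z = ℕ.<⇒≱ ∣z∣<q (∣⇒≤ {{ℕ.>-nonZero (∣∣>0 z≢0)}} q∣z)
  νz≡0 : ν q z ≡ 0
  νz≡0 = ℕ.n≤0⇒n≡0 (ℕ.≮⇒≥ (q∤z ∘ νℕ>0⇒∣ (𝒫⇒prime q 𝒫q) (∣∣>0 z≢0)))

evalPoly-α-≢0 : ∀ p → Prime p → ∀ K d → 1 ≤ d → (a b : ℕ → ℕ → ℤ)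
  → (∀ k n → 1 ≤ k → k ≤ K → 1 ≤ n → a k n ≢ 0ℤ)
  → (∀ k n → 1 ≤ k → k ≤ K → 1 ≤ n → p ∤ gcd ∣ b k n ∣ ∣ a k n ∣)
  → (∀ k → 1 ≤ k → k ≤ K → ∀ N → 1 ≤ N → ∃ (UniqueArgmax (λ n → ν p (a k n)) N))
  → (c : Vec ℕ K → ℤ) → (∀ e → d < deg e → c e ≡ 0ℤ)
  → (e* : Vec ℕ K) → c e* ≢ 0ℤ → (∀ e → e ∈ exps K d → c e ≢ 0ℤ → e ≡ e* ⊎ e <colex e*)
  → Eventually (Growth p a d (ν p (c e*)) K)
  → Eventually λ N → evalPoly K d c (tabulate λ i → α a b (suc (toℕ i)) N) ≢ ℚ.0ℚ
evalPoly-α-≢0 p p-prime K d 1≤d a b a≢0 coprime unique-max c deg-bound e* c*≢0 leading (N₀ , growth) =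
  N₀ ⊔ 1 , λ N N₀⊔1≤N →
    let growth-N = growth N (ℕ.≤-trans (ℕ.m≤m⊔n N₀ 1) N₀⊔1≤N)
    in evalPoly-≢0 p p-prime K d 1≤d c deg-bound e* c*≢0 leading (λ k → α a b k N) (λ k → maxν p a k N)
         (α-exact N (ℕ.≤-trans (ℕ.m≤n⊔m N₀ 1) N₀⊔1≤N) growth-N) growth-N
  where
  open Valuation p p-prime
  α-exact : ∀ N → 1 ≤ N → Growth p a d (ν p (c e*)) K N
    → ∀ k → 1 ≤ k → k ≤ K → Val≡ (α a b k N) 0 (maxν p a k N)
  α-exact N 1≤N growth-N (suc j) 1≤k k≤K with unique-max (suc j) 1≤k k≤K N 1≤N
  ... | n₀ , argmax =
    α-val≡ (a (suc j)) (b (suc j)) N n₀ (λ n 1≤n _ → a≢0 (suc j) n 1≤k k≤K 1≤n)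
           (λ n 1≤n _ → coprime (suc j) n 1≤k k≤K 1≤n) argmax (ℕ.≤-trans (s≤s z≤n) (growth-N j k≤K))

lemma9 : (K d : ℕ) → 1 ≤ K → 1 ≤ d
    → (a b : ℕ → ℕ → ℤ)
    → (∀ k n → 1 ≤ k → k ≤ K → 1 ≤ n → a k n ≢ ℤ.0ℤ)
    → (∀ k n → 1 ≤ k → k ≤ K → 1 ≤ n → b k n ≢ ℤ.0ℤ)
    → (∀ k → 1 ≤ k → k ≤ K → (ε : ℚ) → ℚ.0ℚ ℚ.< ε → ∃ λ M → ∀ N N′ → M ≤ N → M ≤ N′
         → ℚ.∣ α a b k N ℚ.- α a b k N′ ∣ ℚ.< ε)
    → (𝒫 : ℕ → Set)
    → (∀ p → 𝒫 p → Prime p)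
    → ((∃ λ p → ∀ q → 𝒫 q ⇔ (q ≡ p)) ⊎ (∀ B → ∃ λ q → B < q × 𝒫 q))
    → (∀ p k n → 𝒫 p → 1 ≤ k → k ≤ K → 1 ≤ n → ¬ (p ∣ gcd ℤ.∣ b k n ∣ ℤ.∣ a k n ∣))
    → (∀ p k → 𝒫 p → 1 ≤ k → k ≤ K → ∀ N → 1 ≤ N
         → ∃ λ n → 1 ≤ n × n ≤ N × ν p (a k n) ≡ maxUpTo (λ m → ν p (a k m)) N
              × (∀ m → 1 ≤ m → m ≤ N → ν p (a k m) ≡ maxUpTo (λ m → ν p (a k m)) N → m ≡ n))
    → (∀ p j → 𝒫 p → suc j ≤ K → ∃ λ M → ∀ N → M ≤ N
         → d * maxUpTo (λ n → ν p (ext a j n)) N < maxUpTo (λ n → ν p (a (suc j) n)) N)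
    → (∀ p → (∀ q → 𝒫 q ⇔ (q ≡ p)) → ∀ j → suc j ≤ K → ∀ (C : ℕ) → ∃ λ M → ∀ N → M ≤ N
         → C + d * maxUpTo (λ n → ν p (ext a j n)) N < maxUpTo (λ n → ν p (a (suc j) n)) N)
    → (c : Vec ℕ K → ℤ)
    → (∀ e → d < deg e → c e ≡ ℤ.0ℤ)
    → (∃ λ e → c e ≢ ℤ.0ℤ)
    → ∃ λ M → ∀ N → M ≤ N
         → evalPoly K d c (tabulate (λ (i : Fin K) → α a b (suc (toℕ i)) N)) ≢ ℚ.0ℚ
lemma9 K d _ 1≤d a b a≢0 _ _ 𝒫 𝒫⇒prime 𝒫-shape coprime unique-max grow grow-single c deg-bound (e₀ , c₀≢0)
  with colex-max (λ e → c e ≢ 0ℤ) (λ e → ¬? (c e ℤ.≟ 0ℤ)) (exps K d)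
... | inj₂ all-zero = contradiction c₀≢0 (all-zero e₀ (∈-exps K d e₀ (ℕ.≮⇒≥ (c₀≢0 ∘ deg-bound e₀))))
... | inj₁ (e* , _ , c*≢0 , leading)
  with prime-with-growth K d a 𝒫 𝒫⇒prime 𝒫-shape grow grow-single (c e*) c*≢0
...   | p , 𝒫p , growth =
  evalPoly-α-≢0 p (𝒫⇒prime p 𝒫p) K d 1≤d a b a≢0 (λ k n → coprime p k n 𝒫p) (λ k → unique-max p k 𝒫p)
                c deg-bound e* c*≢0 leading growth
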